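{- $\mathsf{RCA_0}$ proves: for every $p\in\mathbb N$ and all $\mathbf u,\mathbf v\in\mathbb N^{<p}$, if $\mathbf u$ is above $\mathbf v$ then $\gamma_p(\mathbf u)>\gamma_p(\mathbf v)$.
   Context: For $\mathbf u\in\mathbb N^{<p}$ (a sequence of natural numbers of length $<p$), $\mathbf u_p\in(\mathbb N\cup\{\omega\})^p$ is obtained by appending $p-\mathrm{length}(\mathbf u)$ copies of $\omega$ to $\mathbf u$. $\mathbf u$ is above $\mathbf v$ iff $\mathbf u_p>_{\mathrm{lex}_p}\mathbf v_p$, where $\mathrm{lex}_p$ is the lexicographic order on $(\omega+1)^p$ (equivalently: $\mathbf v$ properly extends $\mathbf u$, or at the first position where they differ $\mathbf u$ has the larger entry). $\gamma_p(\mathbf u)=\bigoplus_{i=0}^{p-1}\omega^{p-1-i}\cdot(2\cdot\mathbf u_p(i))$, an ordinal below $\omega^\omega$, where $\oplus$ is the natural (Hessenberg) sum and $2\cdot\omega=\omega$. -}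

module Defs where

open import Data.Nat using (ℕ; zero; suc; _+_; _*_; _∸_; _<_; _≡ᵇ_)
open import Data.Bool using (if_then_else_)
open import Data.Fin using (Fin; toℕ)
open import Data.List using (List; []; _∷_)
open import Data.Vec using (Vec; []; _∷_; lookup; tabulate; replicate; zipWith)

data ℕ∞ : Set where
  fin : ℕ → ℕ∞
  ω   : ℕ∞

data _<∞_ : ℕ∞ → ℕ∞ → Set where
  fin<fin : ∀ {m n} → m < n → fin m <∞ fin n
  fin<ω   : ∀ {m} → fin m <∞ ω

data Lex {A : Set} (_≺_ : A → A → Set) : ∀ {n} → Vec A n → Vec A n → Set where
  here  : ∀ {n x y} {xs ys : Vec A n} → x ≺ y → Lex _≺_ (x ∷ xs) (y ∷ ys)
  there : ∀ {n x} {xs ys : Vec A n} → Lex _≺_ xs ys → Lex _≺_ (x ∷ xs) (x ∷ ys)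

-- u_p : pad u with copies of ω up to length p
-- (only used when length u < p, so truncation never happens)
pad : (p : ℕ) → List ℕ → Vec ℕ∞ p
pad zero    _        = []
pad (suc p) []       = ω ∷ pad p []
pad (suc p) (x ∷ xs) = fin x ∷ pad p xs

_<lex_ : ∀ {p} → Vec ℕ∞ p → Vec ℕ∞ p → Set
_<lex_ = Lex _<∞_

Above : (p : ℕ) → List ℕ → List ℕ → Set
Above p u v = pad p v <lex pad p u

-- Ordinals below ω^n in Cantor normal form: the coefficient vector
-- (c_0,…,c_{n-1}) stands for ω^(n-1)·c_0 + … + ω^0·c_{n-1}.
CNF : ℕ → Set
CNF n = Vec ℕ n

_<ₒ_ : ∀ {n} → CNF n → CNF n → Set
_<ₒ_ = Lex _<_

𝟎 : ∀ {n} → CNF n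
𝟎 = replicate _ 0

_⊕_ : ∀ {n} → CNF n → CNF n → CNF n
_⊕_ = zipWith _+_

-- ω^k · c  (c ∈ ℕ) inside CNF n (requires k < n to be meaningful)
mono : (n k c : ℕ) → CNF n
mono zero    k c = []
mono (suc n) k c = (if k ≡ᵇ n then c else 0) ∷ mono n k c

dbl : ℕ∞ → ℕ∞
dbl (fin m) = fin (2 * m)
dbl ω       = ω

-- ω^k · x for x ∈ ω+1, with ω^k·ω = ω^(k+1)
ωpow· : (n k : ℕ) → ℕ∞ → CNF n
ωpow· n k (fin m) = mono n k m
ωpow· n k ω       = mono n (suc k) 1

⨁ : ∀ {n m} → Vec (CNF n) m → CNF n
⨁ []       = 𝟎
⨁ (x ∷ xs) = x ⊕ ⨁ xs

γ : (p : ℕ) → List ℕ → CNF (suc p)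
γ p u = ⨁ (tabulate λ (i : Fin p) → ωpow· (suc p) (p ∸ 1 ∸ toℕ i) (dbl (lookup (pad p u) i)))

module Submission where

-- The term
-- ω^(p-1-i)·(2·x_i) of γ_p only touches coordinate i+1 (value 2·x_i) when
-- x_i is finite, and only coordinate i (value 1) when x_i = ω, since
-- ω^(p-1-i)·ω = ω^(p-i).  Hence the natural sum has the closed form
-- `carryNF 0 x`, computed left to right, where the carry is the value
-- already placed at the current coordinate.
--
-- Next, `carryNF-mono` shows that `carryNF a`
-- is strictly monotone from lex on (ω+1)^p to the ordinal order: the head of
-- `carryNF a x` lies in {a, a+1}, so a jump 2m < 2n at the first difference
-- dominates, and a jump fin m < ω becomes a carry a < a+1.
-- The theorem is the case a = 0 applied to v_p <lex u_p.

open import Defs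
open import Data.Nat using (ℕ; _<_)
open import Data.List using (List; length)
open import Data.Nat using (zero; suc; _*_; _∸_; _≤_; s≤s; _≡ᵇ_)
open import Data.Nat.Properties
  using (≤-refl; <⇒≤; ≤-trans; n≤1+n; n<1+n; m∸n≤m; ∸-+-assoc; *-suc; *-monoʳ-≤; +-identityˡ; +-comm; module ≤-Reasoning)
open import Data.Bool using (true; false)
open import Data.Fin using (Fin; toℕ) renaming (zero to fzero; suc to fsuc)
open import Data.Vec using (Vec; []; _∷_; head; lookup; tabulate)
open import Data.Vec.Properties using (zipWith-identityˡ)
open import Data.Product using (_×_; _,_; proj₁; proj₂)
open import Relation.Binary.PropositionalEquality
  using (_≡_; refl; sym; cong; cong₂; subst; subst₂; module ≡-Reasoning)

≡ᵇ-refl : ∀ n → (n ≡ᵇ n) ≡ true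
≡ᵇ-refl zero    = refl
≡ᵇ-refl (suc n) = ≡ᵇ-refl n

<⇒≡ᵇ-false : ∀ {k n} → k < n → (k ≡ᵇ n) ≡ false
<⇒≡ᵇ-false {zero}  {suc n} _         = refl
<⇒≡ᵇ-false {suc k} {suc n} (s≤s k<n) = <⇒≡ᵇ-false k<n

>⇒≡ᵇ-false : ∀ {k n} → n < k → (k ≡ᵇ n) ≡ false
>⇒≡ᵇ-false {suc k} {zero}  _         = refl
>⇒≡ᵇ-false {suc k} {suc n} (s≤s n<k) = >⇒≡ᵇ-false n<k

mono-below : ∀ {k n} c → k < n → mono (suc n) k c ≡ 0 ∷ mono n k c
mono-below c k<n rewrite <⇒≡ᵇ-false k<n = refl

-- ω^k·c with k ≥ n is out of range of CNF n and is represented by 0.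
mono-above : ∀ n k c → n ≤ k → mono n k c ≡ 𝟎
mono-above zero    k c _   = refl
mono-above (suc n) k c n<k rewrite >⇒≡ᵇ-false n<k =
  cong (0 ∷_) (mono-above n k c (≤-trans (n≤1+n n) n<k))

mono-top : ∀ n c → mono (suc n) n c ≡ c ∷ 𝟎
mono-top n c rewrite ≡ᵇ-refl n = cong (c ∷_) (mono-above n n c ≤-refl)

𝟎⊕ : ∀ {n} (x : CNF n) → 𝟎 ⊕ x ≡ x
𝟎⊕ = zipWith-identityˡ +-identityˡ

⨁-shift : ∀ {n m} (f : Fin m → CNF (suc n)) (g : Fin m → CNF n) →
  (∀ i → f i ≡ 0 ∷ g i) → ⨁ (tabulate f) ≡ 0 ∷ ⨁ (tabulate g)
⨁-shift {m = zero}  f g f≡0∷g = refl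
⨁-shift {m = suc m} f g f≡0∷g =
  cong₂ _⊕_ (f≡0∷g fzero) (⨁-shift (λ i → f (fsuc i)) (λ i → g (fsuc i)) (λ i → f≡0∷g (fsuc i)))

-- ω^k·z with z ∈ ω+1 is at most ω^(k+1); if k+1 < n it misses the leading
-- coordinate of CNF (n+1).
ωpow·-below : ∀ {k n} z → suc k < n → ωpow· (suc n) k z ≡ 0 ∷ ωpow· n k z
ωpow·-below (fin m) 1+k<n = mono-below m (<⇒≤ 1+k<n)
ωpow·-below ω       1+k<n = mono-below 1 1+k<n

Γ : ∀ {p} → Vec ℕ∞ p → CNF (suc p)
Γ {p} x = ⨁ (tabulate λ (i : Fin p) → ωpow· (suc p) (p ∸ 1 ∸ toℕ i) (dbl (lookup x i)))

-- Closed form of Γ: `carryNF a x` is ω^p·a ⊕ Γ x, computed coordinatewise;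
-- an ω entry adds a carry 1 to the current coordinate.
carryNF : ∀ {p} → ℕ → Vec ℕ∞ p → CNF (suc p)
carryNF a []           = a ∷ []
carryNF a (fin m ∷ xs) = a ∷ carryNF (2 * m) xs
carryNF a (ω ∷ xs)     = suc a ∷ carryNF 0 xs

carryNF-split : ∀ {p} a (xs : Vec ℕ∞ p) → carryNF a xs ≡ (a ∷ 𝟎) ⊕ carryNF 0 xs
carryNF-split a []           = cong (_∷ []) (sym (+-comm a 0))
carryNF-split a (fin m ∷ xs) = cong₂ _∷_ (sym (+-comm a 0)) (sym (𝟎⊕ _))
carryNF-split a (ω ∷ xs)     = cong₂ _∷_ (sym (+-comm a 1)) (sym (𝟎⊕ _))

exponent< : ∀ q (i : Fin q) → q ∸ 1 ∸ toℕ i < q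
exponent< (suc r) i = s≤s (m∸n≤m r (toℕ i))

Γ-head : ∀ {q} y (xs : Vec ℕ∞ q) →
  ωpow· (suc (suc q)) q (dbl y) ⊕ (0 ∷ carryNF 0 xs) ≡ carryNF 0 (y ∷ xs)
Γ-head {q} (fin m) xs = begin
    mono (suc (suc q)) q (2 * m) ⊕ (0 ∷ carryNF 0 xs)
  ≡⟨ cong (_⊕ (0 ∷ carryNF 0 xs)) (mono-below (2 * m) (n<1+n q)) ⟩
    (0 ∷ mono (suc q) q (2 * m)) ⊕ (0 ∷ carryNF 0 xs)
  ≡⟨ cong (λ t → (0 ∷ t) ⊕ (0 ∷ carryNF 0 xs)) (mono-top q (2 * m)) ⟩
    0 ∷ (2 * m ∷ 𝟎) ⊕ carryNF 0 xs
  ≡⟨ cong (0 ∷_) (sym (carryNF-split (2 * m) xs)) ⟩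
    0 ∷ carryNF (2 * m) xs
  ∎
  where open ≡-Reasoning
Γ-head {q} ω xs = begin
    mono (suc (suc q)) (suc q) 1 ⊕ (0 ∷ carryNF 0 xs)
  ≡⟨ cong (_⊕ (0 ∷ carryNF 0 xs)) (mono-top (suc q) 1) ⟩
    1 ∷ 𝟎 ⊕ carryNF 0 xs
  ≡⟨ cong (1 ∷_) (𝟎⊕ (carryNF 0 xs)) ⟩
    1 ∷ carryNF 0 xs
  ∎
  where open ≡-Reasoning

Γ≡carryNF : ∀ {p} (x : Vec ℕ∞ p) → Γ x ≡ carryNF 0 x
Γ≡carryNF []               = refl
Γ≡carryNF {suc q} (y ∷ xs) = begin
    ωpow· (suc (suc q)) q (dbl y) ⊕ ⨁ (tabulate tailTerm)
  ≡⟨ cong (ωpow· (suc (suc q)) q (dbl y) ⊕_) (⨁-shift tailTerm _ tailTerm-shift) ⟩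
    ωpow· (suc (suc q)) q (dbl y) ⊕ (0 ∷ Γ xs)
  ≡⟨ cong (λ t → ωpow· (suc (suc q)) q (dbl y) ⊕ (0 ∷ t)) (Γ≡carryNF xs) ⟩
    ωpow· (suc (suc q)) q (dbl y) ⊕ (0 ∷ carryNF 0 xs)
  ≡⟨ Γ-head y xs ⟩
    carryNF 0 (y ∷ xs)
  ∎
  where
  open ≡-Reasoning
  tailTerm : Fin q → CNF (suc (suc q))
  tailTerm i = ωpow· (suc (suc q)) (q ∸ suc (toℕ i)) (dbl (lookup xs i))
  -- q ∸ (1 + i) is q ∸ 1 ∸ i, the exponent of the i-th summand of Γ xs.
  tailTerm-shift : ∀ i → tailTerm i ≡ 0 ∷ ωpow· (suc q) (q ∸ 1 ∸ toℕ i) (dbl (lookup xs i))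
  tailTerm-shift i rewrite sym (∸-+-assoc q 1 (toℕ i)) =
    ωpow·-below (dbl (lookup xs i)) (s≤s (exponent< q i))

carryNF-head : ∀ {p} a (xs : Vec ℕ∞ p) → a ≤ head (carryNF a xs) × head (carryNF a xs) ≤ suc a
carryNF-head a []           = ≤-refl , n≤1+n a
carryNF-head a (fin m ∷ xs) = ≤-refl , n≤1+n a
carryNF-head a (ω ∷ xs)     = n≤1+n a , ≤-refl

double-gap : ∀ {m n} → m < n → suc (2 * m) < 2 * n
double-gap {m} {n} m<n = subst (_≤ 2 * n) (*-suc 2 m) (*-monoʳ-≤ 2 m<n)

head-< : ∀ {n} (x y : CNF (suc n)) → head x < head y → x <ₒ y
head-< (a ∷ x) (b ∷ y) a<b = here a<b

carryNF-mono : ∀ {p} a {xs ys : Vec ℕ∞ p} → xs <lex ys → carryNF a xs <ₒ carryNF a ys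
carryNF-mono a {fin m ∷ xs} {fin n ∷ ys} (here (fin<fin m<n)) =
  there (head-< (carryNF (2 * m) xs) (carryNF (2 * n) ys) (begin-strict
    head (carryNF (2 * m) xs)   ≤⟨ proj₂ (carryNF-head (2 * m) xs) ⟩
    suc (2 * m)                 <⟨ double-gap m<n ⟩
    2 * n                       ≤⟨ proj₁ (carryNF-head (2 * n) ys) ⟩
    head (carryNF (2 * n) ys)   ∎))
  where open ≤-Reasoning
carryNF-mono a {fin m ∷ xs} {ω ∷ ys}     (here fin<ω) = here (n<1+n a)
carryNF-mono a {fin m ∷ xs} {fin m ∷ ys} (there xs<ys) = there (carryNF-mono (2 * m) xs<ys)
carryNF-mono a {ω ∷ xs}     {ω ∷ ys}     (there xs<ys) = there (carryNF-mono 0 xs<ys)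

lemma5p8 : (p : ℕ) (u v : List ℕ) → length u < p → length v < p →
    Above p u v → γ p v <ₒ γ p u
lemma5p8 p u v _ _ v<u =
  subst₂ _<ₒ_ (sym (Γ≡carryNF (pad p v))) (sym (Γ≡carryNF (pad p u))) (carryNF-mono 0 v<u)
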